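{- There is a deterministic algorithm for $k$-median that, given a weighted metric space $(V,w,d)$ of size $n$ and an integer $1\le k\le n$, computes an $O(\log(n/k))$-approximate solution (a set $S\subseteq V$, $|S|\le k$, with $\mathrm{cost}(S)\le O(\log(n/k))\cdot\mathrm{OPT}_k(V)$) using $\tilde O(nk)$ queries to the distance function $d$ (its running time may be exponential).
   Context: A weighted metric space $(V,w,d)$: finite set $V$, weights $w:V\to\mathbb{R}_{\ge0}$, metric $d$. For $S,U\subseteq V$, $d(x,S)=\min_{y\in S}d(x,y)$, $\mathrm{cost}(S,U)=\sum_{x\in U}w(x)d(x,S)$, $\mathrm{cost}(S)=\mathrm{cost}(S,V)$, and $\mathrm{OPT}_k(U)=\min_{S\subseteq U,|S|=k}\mathrm{cost}(S,U)$. The algorithm learns about $d$ only by querying values $d(x,y)$; its query complexity is the number of such queries. $\tilde O(\cdot)$ hides factors polylogarithmic in $n$ and the aspect ratio.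
   Formalization: The weights w and the metric d take values in the nonnegative rationals rather than in $\mathbb{R}_{\ge0}$ and the reals. -}

module Defs where

open import Data.Nat as ℕ using (ℕ; zero; suc; _^_)
open import Data.Integer using (+_)
open import Data.Rational using (ℚ; 0ℚ; _+_; _*_; _⊓_; _≤_; _/_)
open import Data.Fin using (Fin)
open import Data.List using (List; []; _∷_; map; foldr; allFin)
open import Data.Product using (_×_; _,_)
open import Relation.Binary.PropositionalEquality using (_≡_)
open import Relation.Nullary using (¬_)

ℕ→ℚ : ℕ → ℚ
ℕ→ℚ m = (+ m) / 1

record Metric (n : ℕ) : Set where
  field
    d        : Fin n → Fin n → ℚ
    nonneg   : ∀ x y → 0ℚ ≤ d x y
    refl0    : ∀ x → d x x ≡ 0ℚ
    sep      : ∀ x y → d x y ≡ 0ℚ → x ≡ y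
    symm     : ∀ x y → d x y ≡ d y x
    triangle : ∀ x y z → d x z ≤ d x y + d y z
open Metric public

Weights : ℕ → Set
Weights n = Fin n → ℚ

NonNegWeights : ∀ {n} → Weights n → Set
NonNegWeights w = ∀ x → 0ℚ ≤ w x

-- d(x,S) = min over y ∈ S of d(x,y).  Only used for NONEMPTY S
-- (the theorem demands a nonempty output); the value on [] is a dummy 0.
distTo : ∀ {n} → (Fin n → Fin n → ℚ) → Fin n → List (Fin n) → ℚ
distTo d x []       = 0ℚ
distTo d x (y ∷ ys) = foldr (λ z m → d x z ⊓ m) (d x y) ys

cost : ∀ {n} → (Fin n → Fin n → ℚ) → Weights n → List (Fin n) → ℚ
cost {n} d w S = foldr _+_ 0ℚ (map (λ x → w x * distTo d x S) (allFin n))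

-- Query model: a deterministic algorithm on point set Fin n is a decision
-- tree whose internal nodes query d(x,y) and continue depending on the answer,
-- and whose leaves output a set of centres.
data QueryAlg (n : ℕ) : Set where
  output : List (Fin n) → QueryAlg n
  query  : Fin n → Fin n → (ℚ → QueryAlg n) → QueryAlg n

run : ∀ {n} → QueryAlg n → (Fin n → Fin n → ℚ) → List (Fin n) × ℕ
run (output S)    d = S , 0
run (query x y k) d with run (k (d x y)) d
... | S , q = S , suc q

-- Aspect ratio Δ = max d / min nonzero d is at most 2^b.
AspectRatio≤2^ : ∀ {n} → Metric n → ℕ → Set
AspectRatio≤2^ M b =
  ∀ x y u v → ¬ (u ≡ v) → d M x y ≤ ℕ→ℚ (2 ^ b) * d M u v

{-# OPTIONS --safe #-}

-- Divide and conquer: split the points P into halves P₁ and P₂, solve both recursively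
-- (centres R₁ and R₂), query all distances in P × R for R = R₁ ++ R₂ (at most |P|·2k
-- queries), and pick by brute force the best k centres among R. The choice only reads
-- distances in P × R, so it is the same as if it were made with d itself.
--
-- For the analysis fix any k centres T and send every t ∈ T to its nearest point of R.
-- For x ∈ Pᵢ the triangle inequality bounds the distance from x to this projection of T
-- by 2·d(x,T) + d(x,Rᵢ). So if Rᵢ costs at most 2L·cost(T) on Pᵢ, the chosen centres
-- cost at most (2L + 2)·cost(T) on P. When |P| ≤ k·2^L the recursion stops after L
-- levels, giving the factor 2L and at most L·|P|·2k queries.

module Submission where

open import Defs
open import Data.Nat using (ℕ; suc; _+_; _*_; _^_; _≤_)
open import Data.Rational using (ℚ) renaming (_≤_ to _≤ℚ_; _*_ to _*ℚ_)
open import Data.Fin using (Fin)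
open import Data.List using (List; length)
open import Data.List.Relation.Unary.Unique.Propositional using (Unique)
open import Data.Product using (Σ; _×_; proj₁; proj₂)
open import Relation.Binary.PropositionalEquality using (_≡_)

open import Data.Nat using (zero; z≤n; s≤s; >-nonZero; _<_; _∸_; _⊓_; _≤?_; ⌈_/2⌉; ⌊_/2⌋)
import Data.Nat.Properties as ℕₚ
open import Data.Nat.Coprimality using (1-coprimeTo) renaming (sym to coprime-sym)
open import Data.Integer using (+_; +≤+) renaming (_≤_ to _≤ℤ_)
import Data.Integer.Properties as ℤₚ
open import Data.Rational using (0ℚ; mkℚ; *≤*; nonNegative)
  renaming (_+_ to _+ℚ_; _⊓_ to _⊓ℚ_)
import Data.Rational.Properties as ℚₚ
open import Data.Fin using (_≟_)
open import Data.List using ([]; _∷_; _++_; map; foldr; take; drop; cartesianProduct; cartesianProductWith; allFin)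
import Data.List.Properties as Listₚ
open import Data.List.Membership.Propositional using (_∈_)
open import Data.List.Membership.Propositional.Properties
  using (∈-map⁺; ∈-map⁻; ∈-++⁺ˡ; ∈-++⁺ʳ; ∈-cartesianProductWith⁺; ∈-cartesianProductWith⁻; ∈-cartesianProduct⁺; foldr-selective)
open import Data.List.Relation.Binary.Subset.Propositional using (_⊆_)
open import Data.List.Relation.Unary.Any as Any using (Any; here; there)
open import Data.List.Relation.Unary.All as All using (All; []; _∷_)
import Data.List.Relation.Unary.All.Properties as Allₚ
import Data.List.Extrema
open import Data.Product using (_,_; ∃-syntax)
open import Data.Sum using (_⊎_; inj₁; inj₂; [_,_]′)
open import Function using (_∘_; id)
open import Relation.Binary.Bundles using (TotalOrder; DecTotalOrder)
open import Relation.Binary.PropositionalEquality using (refl; sym; trans; cong; cong₂; subst; subst₂; module ≡-Reasoning)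
open import Algebra.Bundles using (CommutativeMonoid)
open import Algebra.Properties.CommutativeSemigroup
  (CommutativeMonoid.commutativeSemigroup ℚₚ.+-0-commutativeMonoid) renaming (interchange to +-interchange)
open import Data.Rational.Solver using (module +-*-Solver)
import Data.Nat.Solver as ℕ-Solver
open import Relation.Nullary using (yes; no; contradiction)

ℕ→ℚ-mkℚ : ∀ m → ℕ→ℚ m ≡ mkℚ (+ m) 0 (coprime-sym (1-coprimeTo m))
ℕ→ℚ-mkℚ m = ℚₚ.normalize-coprime (coprime-sym (1-coprimeTo m))

ℕ→ℚ-+ : ∀ a b → ℕ→ℚ (a + b) ≡ ℕ→ℚ a +ℚ ℕ→ℚ b
ℕ→ℚ-+ a b rewrite ℕ→ℚ-mkℚ a | ℕ→ℚ-mkℚ b | ℤₚ.*-identityʳ (+ a) | ℤₚ.*-identityʳ (+ b) = refl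

ℕ→ℚ-mono : ∀ {a b} → a ≤ b → ℕ→ℚ a ≤ℚ ℕ→ℚ b
ℕ→ℚ-mono {a} {b} a≤b rewrite ℕ→ℚ-mkℚ a | ℕ→ℚ-mkℚ b =
  *≤* (subst₂ _≤ℤ_ (sym (ℤₚ.*-identityʳ (+ a))) (sym (ℤₚ.*-identityʳ (+ b))) (+≤+ a≤b))

*-nonneg : ∀ {p q} → 0ℚ ≤ℚ p → 0ℚ ≤ℚ q → 0ℚ ≤ℚ p *ℚ q
*-nonneg {p} {q} 0≤p 0≤q =
  ℚₚ.nonNegative⁻¹ _ {{ℚₚ.nonNeg*nonNeg⇒nonNeg p {{nonNegative 0≤p}} q {{nonNegative 0≤q}}}}

n<2^n : ∀ n → n < 2 ^ n
n<2^n zero    = s≤s z≤n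
n<2^n (suc n) = ℕₚ.+-mono-≤ (ℕₚ.m^n>0 2 n) (ℕₚ.≤-trans (n<2^n n) (ℕₚ.m≤m+n (2 ^ n) 0))

sumℚ : {A : Set} → (A → ℚ) → List A → ℚ
sumℚ f xs = foldr _+ℚ_ 0ℚ (map f xs)

module _ {A : Set} where

  sumℚ-++ : ∀ (f : A → ℚ) xs ys → sumℚ f (xs ++ ys) ≡ sumℚ f xs +ℚ sumℚ f ys
  sumℚ-++ f []       ys = sym (ℚₚ.+-identityˡ (sumℚ f ys))
  sumℚ-++ f (x ∷ xs) ys rewrite sumℚ-++ f xs ys = sym (ℚₚ.+-assoc (f x) (sumℚ f xs) (sumℚ f ys))

  sumℚ-+ : ∀ (f g : A → ℚ) xs → sumℚ (λ x → f x +ℚ g x) xs ≡ sumℚ f xs +ℚ sumℚ g xs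
  sumℚ-+ f g []       = refl
  sumℚ-+ f g (x ∷ xs) rewrite sumℚ-+ f g xs = +-interchange (f x) (g x) (sumℚ f xs) (sumℚ g xs)

  sumℚ-*ˡ : ∀ c (f : A → ℚ) xs → sumℚ (λ x → c *ℚ f x) xs ≡ c *ℚ sumℚ f xs
  sumℚ-*ˡ c f []       = sym (ℚₚ.*-zeroʳ c)
  sumℚ-*ˡ c f (x ∷ xs) rewrite sumℚ-*ˡ c f xs = sym (ℚₚ.*-distribˡ-+ c (f x) (sumℚ f xs))

  sumℚ-cong : ∀ {f g : A → ℚ} xs → (∀ {x} → x ∈ xs → f x ≡ g x) → sumℚ f xs ≡ sumℚ g xs
  sumℚ-cong []       f≡g = refl
  sumℚ-cong (x ∷ xs) f≡g = cong₂ _+ℚ_ (f≡g (here refl)) (sumℚ-cong xs (f≡g ∘ there))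

  sumℚ-mono : ∀ {f g : A → ℚ} xs → (∀ {x} → x ∈ xs → f x ≤ℚ g x) → sumℚ f xs ≤ℚ sumℚ g xs
  sumℚ-mono []       f≤g = ℚₚ.≤-refl
  sumℚ-mono (x ∷ xs) f≤g = ℚₚ.+-mono-≤ (f≤g (here refl)) (sumℚ-mono xs (f≤g ∘ there))

  sumℚ-nonneg : ∀ {f : A → ℚ} xs → (∀ {x} → x ∈ xs → 0ℚ ≤ℚ f x) → 0ℚ ≤ℚ sumℚ f xs
  sumℚ-nonneg []       0≤f = ℚₚ.≤-refl
  sumℚ-nonneg (x ∷ xs) 0≤f = ℚₚ.+-mono-≤ (0≤f (here refl)) (sumℚ-nonneg xs (0≤f ∘ there))

  sumℚ-0 : ∀ xs → sumℚ (λ (_ : A) → 0ℚ) xs ≡ 0ℚ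
  sumℚ-0 []       = refl
  sumℚ-0 (x ∷ xs) rewrite sumℚ-0 xs = refl

module _ {b ℓ₁ ℓ₂} (O : TotalOrder b ℓ₁ ℓ₂) where
  open TotalOrder O using (Carrier)
  open Data.List.Extrema O using (argmin; argmin-all)
  open import Algebra.Construct.NaturalChoice.Min O using (⊓-sel)
  open import Function using (const)

  -- argmin f ⊤ (x ∷ xs) picks x or argmin f ⊤ xs by ⊓-sel on their f-values alone.
  argmin-cong : ∀ {A : Set} {f g : A → Carrier} ⊤ xs →
                f ⊤ ≡ g ⊤ → All (λ x → f x ≡ g x) xs → argmin f ⊤ xs ≡ argmin g ⊤ xs
  argmin-cong ⊤ []       f⊤≡g⊤ []            = refl
  argmin-cong {f = f} {g} ⊤ (x ∷ xs) f⊤≡g⊤ (fx≡gx ∷ fxs≡gxs)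
    rewrite argmin-cong ⊤ xs f⊤≡g⊤ fxs≡gxs =
    cong₂ (λ u v → [ const x , const (argmin g ⊤ xs) ]′ (⊓-sel u v)) fx≡gx (argmin-all g f⊤≡g⊤ fxs≡gxs)

ℚ-totalOrder : TotalOrder _ _ _
ℚ-totalOrder = DecTotalOrder.totalOrder ℚₚ.≤-decTotalOrder

open Data.List.Extrema ℚ-totalOrder using (argmin; argmin-all; f[argmin]≤f[xs])

module _ {A : Set} where

  tuples : ℕ → List A → List (List A)
  tuples zero    xs = [] ∷ []
  tuples (suc j) xs = cartesianProductWith _∷_ xs (tuples j xs)

  ∈-tuples⁺ : ∀ {xs ys : List A} → ys ⊆ xs → ys ∈ tuples (length ys) xs
  ∈-tuples⁺ {ys = []}     ys⊆xs = here refl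
  ∈-tuples⁺ {ys = y ∷ ys} ys⊆xs = ∈-cartesianProductWith⁺ _∷_ (ys⊆xs (here refl)) (∈-tuples⁺ (ys⊆xs ∘ there))

  ∈-tuples⁻ : ∀ j {xs ys : List A} → ys ∈ tuples j xs → length ys ≡ j × ys ⊆ xs
  ∈-tuples⁻ zero    (here refl) = refl , λ ()
  ∈-tuples⁻ (suc j) {xs} ys∈ with ∈-cartesianProductWith⁻ _∷_ xs (tuples j xs) ys∈
  ... | y , zs , y∈xs , zs∈ , refl with ∈-tuples⁻ j zs∈
  ...   | |zs|≡j , zs⊆xs = cong suc |zs|≡j , λ { (here refl) → y∈xs ; (there z∈zs) → zs⊆xs z∈zs }

  take-⊆ : ∀ m (xs : List A) → take m xs ⊆ xs
  take-⊆ m xs = All.lookup (Allₚ.take⁺ m (All.tabulate {xs = xs} id))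

  ∈⇒nonempty : ∀ {x : A} {xs} → x ∈ xs → 1 ≤ length xs
  ∈⇒nonempty {xs = _ ∷ _} _ = s≤s z≤n

  take-nonempty : ∀ {m} (xs : List A) → 1 ≤ m → 1 ≤ length xs → 1 ≤ length (take m xs)
  take-nonempty {suc m} (x ∷ xs) _ _ = s≤s z≤n

  firstHalf secondHalf : List A → List A
  firstHalf  xs = take ⌈ length xs /2⌉ xs
  secondHalf xs = drop ⌈ length xs /2⌉ xs

  firstHalf-nonempty : ∀ (xs : List A) → 1 ≤ length xs → 1 ≤ length (firstHalf xs)
  firstHalf-nonempty (x ∷ xs) _ = s≤s z≤n

  firstHalf++secondHalf : ∀ xs → firstHalf xs ++ secondHalf xs ≡ xs
  firstHalf++secondHalf xs = Listₚ.take++drop≡id ⌈ length xs /2⌉ xs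

  length-halves : ∀ xs → length (firstHalf xs) + length (secondHalf xs) ≡ length xs
  length-halves xs = trans (sym (Listₚ.length-++ (firstHalf xs))) (cong length (firstHalf++secondHalf xs))

  halves-≤ : ∀ {m} xs → length xs ≤ m + m → length (firstHalf xs) ≤ m × length (secondHalf xs) ≤ m
  halves-≤ {m} xs |xs|≤2m = first , second
    where
    p : ℕ
    p = length xs
    first : length (firstHalf xs) ≤ m
    first = begin
      length (take ⌈ p /2⌉ xs) ≡⟨ Listₚ.length-take ⌈ p /2⌉ xs ⟩
      ⌈ p /2⌉ ⊓ p              ≤⟨ ℕₚ.m⊓n≤m ⌈ p /2⌉ p ⟩
      ⌈ p /2⌉                  ≤⟨ ℕₚ.⌈n/2⌉-mono |xs|≤2m ⟩
      ⌈ m + m /2⌉              ≡⟨ sym (ℕₚ.n≡⌈n+n/2⌉ m) ⟩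
      m                        ∎
      where open ℕₚ.≤-Reasoning
    second : length (secondHalf xs) ≤ m
    second = begin
      length (drop ⌈ p /2⌉ xs) ≡⟨ Listₚ.length-drop ⌈ p /2⌉ xs ⟩
      p ∸ ⌈ p /2⌉              ≡⟨ cong (_∸ ⌈ p /2⌉) (sym (ℕₚ.⌊n/2⌋+⌈n/2⌉≡n p)) ⟩
      ⌊ p /2⌋ + ⌈ p /2⌉ ∸ ⌈ p /2⌉ ≡⟨ ℕₚ.m+n∸n≡m ⌊ p /2⌋ ⌈ p /2⌉ ⟩
      ⌊ p /2⌋                  ≤⟨ ℕₚ.⌊n/2⌋-mono |xs|≤2m ⟩
      ⌊ m + m /2⌋              ≡⟨ sym (ℕₚ.n≡⌊n+n/2⌋ m) ⟩
      m                        ∎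
      where open ℕₚ.≤-Reasoning

  halves-≤-2^ : ∀ k m xs → length xs ≤ k * 2 ^ suc m →
                length (firstHalf xs) ≤ k * 2 ^ m × length (secondHalf xs) ≤ k * 2 ^ m
  halves-≤-2^ k m xs |xs|≤ = halves-≤ xs (ℕₚ.≤-trans |xs|≤ (ℕₚ.≤-reflexive k*2^[1+m]))
    where
    k*2^[1+m] : k * 2 ^ suc m ≡ k * 2 ^ m + k * 2 ^ m
    k*2^[1+m] = trans (cong (k *_) (cong (_+_ (2 ^ m)) (ℕₚ.+-identityʳ (2 ^ m)))) (ℕₚ.*-distribˡ-+ k (2 ^ m) (2 ^ m))

module _ {A B : Set} where

  length-cartesianProduct : ∀ (xs : List A) (ys : List B) →
                            length (cartesianProduct xs ys) ≡ length xs * length ys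
  length-cartesianProduct []       ys = refl
  length-cartesianProduct (x ∷ xs) ys = begin
    length (map (x ,_) ys ++ cartesianProduct xs ys)       ≡⟨ Listₚ.length-++ (map (x ,_) ys) ⟩
    length (map (x ,_) ys) + length (cartesianProduct xs ys) ≡⟨ cong₂ _+_ (Listₚ.length-map (x ,_) ys) (length-cartesianProduct xs ys) ⟩
    length ys + length xs * length ys                      ∎
    where open ≡-Reasoning

Distance : ℕ → Set
Distance n = Fin n → Fin n → ℚ

module _ {n} (d : Distance n) where

  distTo-∷ : ∀ x y ys → distTo d x (y ∷ ys) ≡ foldr _⊓ℚ_ (d x y) (map (d x) ys)
  distTo-∷ x y ys = sym (Listₚ.foldr-map _⊓ℚ_ (d x) (d x y) ys)

  distTo-≤ : ∀ x {S z} → z ∈ S → distTo d x S ≤ℚ d x z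
  distTo-≤ x {y ∷ ys} {z} z∈S rewrite distTo-∷ x y ys =
    Listₚ.foldr-preservesᵒ {P = _≤ℚ d x z} min-≤ (d x y) (map (d x) ys) (witness z∈S)
    where
    min-≤ : ∀ u v → u ≤ℚ d x z ⊎ v ≤ℚ d x z → u ⊓ℚ v ≤ℚ d x z
    min-≤ u v = [ ℚₚ.p≤q⇒p⊓r≤q v , ℚₚ.p≤q⇒r⊓p≤q u ]′
    witness : z ∈ y ∷ ys → d x y ≤ℚ d x z ⊎ Any (_≤ℚ d x z) (map (d x) ys)
    witness (here refl)  = inj₁ ℚₚ.≤-refl
    witness (there z∈ys) = inj₂ (Any.map (ℚₚ.≤-reflexive ∘ sym) (∈-map⁺ (d x) z∈ys))

  distTo-attained : ∀ x S → 1 ≤ length S → ∃[ z ] z ∈ S × distTo d x S ≡ d x z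
  distTo-attained x (y ∷ ys) _ with foldr-selective ℚₚ.⊓-sel (d x y) (map (d x) ys)
  ... | inj₁ min≡dxy = y , here refl , trans (distTo-∷ x y ys) min≡dxy
  ... | inj₂ min∈ with ∈-map⁻ (d x) min∈
  ...   | z , z∈ys , min≡dxz = z , there z∈ys , trans (distTo-∷ x y ys) min≡dxz

  nearest : (R : List (Fin n)) → 1 ≤ length R → Fin n → Fin n
  nearest R 1≤|R| x = proj₁ (distTo-attained x R 1≤|R|)

  nearest-∈ : ∀ R 1≤|R| x → nearest R 1≤|R| x ∈ R
  nearest-∈ R 1≤|R| x = proj₁ (proj₂ (distTo-attained x R 1≤|R|))

  nearest-≤ : ∀ R 1≤|R| x {z} → z ∈ R → d x (nearest R 1≤|R| x) ≤ℚ d x z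
  nearest-≤ R 1≤|R| x z∈R =
    subst (_≤ℚ _) (proj₂ (proj₂ (distTo-attained x R 1≤|R|))) (distTo-≤ x z∈R)

distTo-cong : ∀ {n} {d e : Distance n} x S → (∀ {z} → z ∈ S → d x z ≡ e x z) → distTo d x S ≡ distTo e x S
distTo-cong {d = d} {e} x (y ∷ ys) d≡e = begin
  distTo d x (y ∷ ys)                ≡⟨ distTo-∷ d x y ys ⟩
  foldr _⊓ℚ_ (d x y) (map (d x) ys)  ≡⟨ cong₂ (foldr _⊓ℚ_) (d≡e (here refl)) (Listₚ.map-cong-local (All.tabulate (d≡e ∘ there))) ⟩
  foldr _⊓ℚ_ (e x y) (map (e x) ys)  ≡⟨ sym (distTo-∷ e x y ys) ⟩
  distTo e x (y ∷ ys)                ∎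
  where open ≡-Reasoning
distTo-cong x [] d≡e = refl

module _ {n} (M : Metric n) where

  distTo-nonneg : ∀ x S → 0ℚ ≤ℚ distTo (d M) x S
  distTo-nonneg x []         = ℚₚ.≤-refl
  distTo-nonneg x S@(_ ∷ _) with distTo-attained (d M) x S (s≤s z≤n)
  ... | z , _ , dist≡dxz = subst (0ℚ ≤ℚ_) (sym dist≡dxz) (nonneg M x z)

  distTo-self : ∀ {x S} → x ∈ S → distTo (d M) x S ≡ 0ℚ
  distTo-self {x} {S} x∈S =
    ℚₚ.≤-antisym (ℚₚ.≤-trans (distTo-≤ (d M) x x∈S) (ℚₚ.≤-reflexive (refl0 M x))) (distTo-nonneg x S)

  detour-≤ : ∀ x t {c r} → d M t c ≤ℚ d M t r → d M x c ≤ℚ ℕ→ℚ 2 *ℚ d M x t +ℚ d M x r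
  detour-≤ x t {c} {r} c-closer = begin
    d M x c                       ≤⟨ triangle M x t c ⟩
    d M x t +ℚ d M t c            ≤⟨ ℚₚ.+-monoʳ-≤ (d M x t) c-closer ⟩
    d M x t +ℚ d M t r            ≤⟨ ℚₚ.+-monoʳ-≤ (d M x t) (triangle M t x r) ⟩
    d M x t +ℚ (d M t x +ℚ d M x r) ≡⟨ cong (λ u → d M x t +ℚ (u +ℚ d M x r)) (symm M t x) ⟩
    d M x t +ℚ (d M x t +ℚ d M x r) ≡⟨ double (d M x t) (d M x r) ⟩
    ℕ→ℚ 2 *ℚ d M x t +ℚ d M x r   ∎
    where
    open ℚₚ.≤-Reasoning
    open +-*-Solver
    double : ∀ a b → a +ℚ (a +ℚ b) ≡ ℕ→ℚ 2 *ℚ a +ℚ b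
    double = solve 2 (λ a b → a :+ (a :+ b) := con (ℕ→ℚ 2) :* a :+ b) refl

module _ {n : ℕ} where

  _>>=_ : QueryAlg n → (List (Fin n) → QueryAlg n) → QueryAlg n
  output S    >>= κ = κ S
  query x y g >>= κ = query x y (λ v → g v >>= κ)

  run->>= : ∀ m κ (d : Distance n) {S q S′ q′} →
            run m d ≡ (S , q) → run (κ S) d ≡ (S′ , q′) → run (m >>= κ) d ≡ (S′ , q + q′)
  run->>= (output S)    κ d refl run-κ = run-κ
  run->>= (query x y g) κ d run-m run-κ with run (g (d x y)) d in run-g
  run->>= (query x y g) κ d refl run-κ | S , q rewrite run->>= (g (d x y)) κ d run-g run-κ = refl

  write : Fin n → Fin n → ℚ → Distance n → Distance n
  write x y v f a b with a ≟ x | b ≟ y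
  ... | yes _ | yes _ = v
  ... | _     | _     = f a b

  write-same : ∀ x y v f → write x y v f x y ≡ v
  write-same x y v f with x ≟ x | y ≟ y
  ... | yes _   | yes _   = refl
  ... | yes _   | no y≢y  = contradiction refl y≢y
  ... | no x≢x  | _       = contradiction refl x≢x

  write-agrees : ∀ (d f : Distance n) x y {a b} → f a b ≡ d a b → write x y (d x y) f a b ≡ d a b
  write-agrees d f x y {a} {b} fab≡dab with a ≟ x | b ≟ y
  ... | yes refl | yes refl = refl
  ... | yes _    | no _     = fab≡dab
  ... | no _     | _        = fab≡dab

  queryAll : List (Fin n × Fin n) → (Distance n → QueryAlg n) → QueryAlg n
  queryAll []             κ = κ (λ _ _ → 0ℚ)
  queryAll ((x , y) ∷ ps) κ = query x y (λ v → queryAll ps (κ ∘ write x y v))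

  run-queryAll : ∀ (d : Distance n) ps κ →
                 ∃[ f ] (∀ {a b} → (a , b) ∈ ps → f a b ≡ d a b)
                      × run (queryAll ps κ) d ≡ (let (S , q) = run (κ f) d in S , length ps + q)
  run-queryAll d []             κ = (λ _ _ → 0ℚ) , (λ ()) , refl
  run-queryAll d ((x , y) ∷ ps) κ with run-queryAll d ps (κ ∘ write x y (d x y))
  ... | f , f≈d , run≡ = write x y (d x y) f , agrees , run-query
    where
    agrees : ∀ {a b} → (a , b) ∈ (x , y) ∷ ps → write x y (d x y) f a b ≡ d a b
    agrees (here refl)  = write-same x y (d x y) f
    agrees (there ab∈ps) = write-agrees d f x y (f≈d ab∈ps)
    run-query : run (queryAll ((x , y) ∷ ps) κ) d
              ≡ (let (S , q) = run (κ (write x y (d x y) f)) d in S , length ((x , y) ∷ ps) + q)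
    run-query rewrite run≡ = refl

module KMedian (n k : ℕ) (w : Weights n) where

  costOn : Distance n → List (Fin n) → List (Fin n) → ℚ
  costOn d P S = sumℚ (λ x → w x *ℚ distTo d x S) P

  -- take k R is only the default that argmin needs (tuples k R is empty when R is);
  -- it too consists of at most k points of R.
  bestCentres : Distance n → List (Fin n) → List (Fin n) → List (Fin n)
  bestCentres d P R = argmin (costOn d P) (take k R) (tuples k R)

  queryBestCentres : List (Fin n) → List (Fin n) → QueryAlg n
  queryBestCentres P R = queryAll (cartesianProduct P R) λ f → output (bestCentres f P R)

  -- D is the remaining recursion depth; kMedian uses D = n, enough since n ≤ k·2ⁿ.
  solveOn : ℕ → List (Fin n) → QueryAlg n
  solveOn zero    P = output P
  solveOn (suc D) P with length P ≤? k
  ... | yes _ = output P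
  ... | no  _ =
    solveOn D (firstHalf P)  >>= λ R₁ →
    solveOn D (secondHalf P) >>= λ R₂ →
    queryBestCentres P (R₁ ++ R₂)

  kMedian : QueryAlg n
  kMedian = solveOn n (allFin n)

  costOn-cong : ∀ {d e : Distance n} P S → (∀ {x z} → x ∈ P → z ∈ S → d x z ≡ e x z) →
                costOn d P S ≡ costOn e P S
  costOn-cong P S d≡e = sumℚ-cong P (λ x∈P → cong (w _ *ℚ_) (distTo-cong _ S (d≡e x∈P)))

  costOn-halves : ∀ d P S → costOn d P S ≡ costOn d (firstHalf P) S +ℚ costOn d (secondHalf P) S
  costOn-halves d P S = begin
    costOn d P S                                      ≡⟨ cong (λ Q → costOn d Q S) (sym (firstHalf++secondHalf P)) ⟩
    costOn d (firstHalf P ++ secondHalf P) S          ≡⟨ sumℚ-++ _ (firstHalf P) (secondHalf P) ⟩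
    costOn d (firstHalf P) S +ℚ costOn d (secondHalf P) S ∎
    where open ≡-Reasoning

  bestCentres-length : ∀ d P R → length (bestCentres d P R) ≤ k
  bestCentres-length d P R = argmin-all (costOn d P) take-short (All.tabulate tuple-short)
    where
    take-short : length (take k R) ≤ k
    take-short = ℕₚ.≤-trans (ℕₚ.≤-reflexive (Listₚ.length-take k R)) (ℕₚ.m⊓n≤m k (length R))
    tuple-short : ∀ {c} → c ∈ tuples k R → length c ≤ k
    tuple-short = ℕₚ.≤-reflexive ∘ proj₁ ∘ ∈-tuples⁻ k

  bestCentres-nonempty : ∀ d P R → 1 ≤ k → 1 ≤ length R → 1 ≤ length (bestCentres d P R)
  bestCentres-nonempty d P R 1≤k 1≤|R| =
    argmin-all (costOn d P) (take-nonempty R 1≤k 1≤|R|) (All.tabulate tuple-nonempty)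
    where
    tuple-nonempty : ∀ {c} → c ∈ tuples k R → 1 ≤ length c
    tuple-nonempty c∈ = subst (1 ≤_) (sym (proj₁ (∈-tuples⁻ k c∈))) 1≤k

  bestCentres-optimal : ∀ d P R {c} → c ∈ tuples k R → costOn d P (bestCentres d P R) ≤ℚ costOn d P c
  bestCentres-optimal d P R = All.lookup (f[argmin]≤f[xs] (take k R) (tuples k R))

  bestCentres-cong : ∀ {d e : Distance n} P R → (∀ {x z} → x ∈ P → z ∈ R → d x z ≡ e x z) →
                     bestCentres d P R ≡ bestCentres e P R
  bestCentres-cong {d} {e} P R d≡e =
    argmin-cong ℚ-totalOrder (take k R) (tuples k R)
      (agree (take-⊆ k R)) (All.tabulate (λ c∈ → agree (proj₂ (∈-tuples⁻ k c∈))))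
    where
    agree : ∀ {c} → c ⊆ R → costOn d P c ≡ costOn e P c
    agree c⊆R = costOn-cong P _ (λ x∈P z∈c → d≡e x∈P (c⊆R z∈c))

  module Semantics (d : Distance n) where

    centres : ℕ → List (Fin n) → List (Fin n)
    centres zero    P = P
    centres (suc D) P with length P ≤? k
    ... | yes _ = P
    ... | no  _ = bestCentres d P (centres D (firstHalf P) ++ centres D (secondHalf P))

    queries : ℕ → List (Fin n) → ℕ
    queries zero    P = 0
    queries (suc D) P with length P ≤? k
    ... | yes _ = 0
    ... | no  _ = queries D (firstHalf P) + (queries D (secondHalf P)
                  + length P * length (centres D (firstHalf P) ++ centres D (secondHalf P)))

    run-queryBestCentres : ∀ P R → run (queryBestCentres P R) d ≡ (bestCentres d P R , length P * length R)
    run-queryBestCentres P R with run-queryAll d (cartesianProduct P R) (λ f → output (bestCentres f P R))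
    ... | f , f≈d , run≡ = begin
      run (queryBestCentres P R) d                                 ≡⟨ run≡ ⟩
      (bestCentres f P R , length (cartesianProduct P R) + 0)      ≡⟨ cong₂ _,_ best≡ count≡ ⟩
      (bestCentres d P R , length P * length R)                   ∎
      where
      open ≡-Reasoning
      best≡ : bestCentres f P R ≡ bestCentres d P R
      best≡ = bestCentres-cong P R (λ x∈P z∈R → f≈d (∈-cartesianProduct⁺ x∈P z∈R))
      count≡ : length (cartesianProduct P R) + 0 ≡ length P * length R
      count≡ = trans (ℕₚ.+-identityʳ _) (length-cartesianProduct P R)

    run-solveOn : ∀ D P → run (solveOn D P) d ≡ (centres D P , queries D P)
    run-solveOn zero    P = refl
    run-solveOn (suc D) P with length P ≤? k
    ... | yes _ = refl
    ... | no  _ =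
      run->>= (solveOn D (firstHalf P)) _ d (run-solveOn D (firstHalf P))
        (run->>= (solveOn D (secondHalf P)) _ d (run-solveOn D (secondHalf P))
          (run-queryBestCentres P (centres D (firstHalf P) ++ centres D (secondHalf P))))

    centres-length : ∀ D P → length P ≤ k * 2 ^ D → length (centres D P) ≤ k
    centres-length zero    P |P|≤k = subst (length P ≤_) (ℕₚ.*-identityʳ k) |P|≤k
    centres-length (suc D) P _ with length P ≤? k
    ... | yes |P|≤k = |P|≤k
    ... | no  _     = bestCentres-length d P _

    centres-nonempty : ∀ D P → 1 ≤ k → 1 ≤ length P → 1 ≤ length (centres D P)
    centres-nonempty zero    P 1≤k 1≤|P| = 1≤|P|
    centres-nonempty (suc D) P 1≤k 1≤|P| with length P ≤? k
    ... | yes _ = 1≤|P|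
    ... | no  _ = bestCentres-nonempty d P (R₁ ++ centres D (secondHalf P)) 1≤k
                    (ℕₚ.≤-trans (centres-nonempty D (firstHalf P) 1≤k (firstHalf-nonempty P 1≤|P|))
                                (Listₚ.length-++-≤ˡ R₁))
      where
      R₁ : List (Fin n)
      R₁ = centres D (firstHalf P)

    queries-≤ : ∀ D L P → length P ≤ k * 2 ^ D → length P ≤ k * 2 ^ L →
                queries D P ≤ L * length P * (k + k)
    queries-≤ zero    L P _ _ = z≤n
    queries-≤ (suc D) L P fuel size with length P ≤? k
    queries-≤ (suc D) L       P fuel size | yes _ = z≤n
    queries-≤ (suc D) zero    P fuel size | no |P|≰k =
      contradiction (subst (length P ≤_) (ℕₚ.*-identityʳ k) size) |P|≰k
    queries-≤ (suc D) (suc L) P fuel size | no _ = begin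
      queries D P₁ + (queries D P₂ + p * length (R₁ ++ R₂))
        ≤⟨ ℕₚ.+-mono-≤ (queries-≤ D L P₁ fuel₁ size₁)
             (ℕₚ.+-mono-≤ (queries-≤ D L P₂ fuel₂ size₂) (ℕₚ.*-monoʳ-≤ p |R|≤2k)) ⟩
      L * p₁ * (k + k) + (L * p₂ * (k + k) + p * (k + k))
        ≡⟨ cong (λ m → L * p₁ * (k + k) + (L * p₂ * (k + k) + m * (k + k))) (sym (length-halves P)) ⟩
      L * p₁ * (k + k) + (L * p₂ * (k + k) + (p₁ + p₂) * (k + k))
        ≡⟨ regroup L p₁ p₂ (k + k) ⟩
      suc L * (p₁ + p₂) * (k + k)
        ≡⟨ cong (λ m → suc L * m * (k + k)) (length-halves P) ⟩
      suc L * p * (k + k) ∎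
      where
      open ℕₚ.≤-Reasoning
      open ℕ-Solver.+-*-Solver using (solve; _:+_; _:*_; _:=_; con)
      P₁ P₂ R₁ R₂ : List (Fin n)
      P₁ = firstHalf P
      P₂ = secondHalf P
      R₁ = centres D P₁
      R₂ = centres D P₂
      p p₁ p₂ : ℕ
      p = length P
      p₁ = length P₁
      p₂ = length P₂
      fuel₁ : p₁ ≤ k * 2 ^ D
      fuel₁ = proj₁ (halves-≤-2^ k D P fuel)
      fuel₂ : p₂ ≤ k * 2 ^ D
      fuel₂ = proj₂ (halves-≤-2^ k D P fuel)
      size₁ : p₁ ≤ k * 2 ^ L
      size₁ = proj₁ (halves-≤-2^ k L P size)
      size₂ : p₂ ≤ k * 2 ^ L
      size₂ = proj₂ (halves-≤-2^ k L P size)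
      |R|≤2k : length (R₁ ++ R₂) ≤ k + k
      |R|≤2k = ℕₚ.≤-trans (ℕₚ.≤-reflexive (Listₚ.length-++ R₁))
                          (ℕₚ.+-mono-≤ (centres-length D P₁ fuel₁) (centres-length D P₂ fuel₂))
      regroup : ∀ l a b c → l * a * c + (l * b * c + (a + b) * c) ≡ suc l * (a + b) * c
      regroup = solve 4 (λ l a b c → l :* a :* c :+ (l :* b :* c :+ (a :+ b) :* c)
                                      := (con 1 :+ l) :* (a :+ b) :* c) refl

  module Approximation (M : Metric n) (w≥0 : NonNegWeights w) (1≤k : 1 ≤ k)
                       (T : List (Fin n)) (|T|≡k : length T ≡ k) where
    open Semantics (d M)

    w*-mono : ∀ x {a b} → a ≤ℚ b → w x *ℚ a ≤ℚ w x *ℚ b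
    w*-mono x = ℚₚ.*-monoˡ-≤-nonNeg (w x) {{nonNegative (w≥0 x)}}

    cost-nonneg : ∀ P S → 0ℚ ≤ℚ costOn (d M) P S
    cost-nonneg P S = sumℚ-nonneg P (λ {x} _ → *-nonneg (w≥0 x) (distTo-nonneg M x S))

    cost-self : ∀ P → costOn (d M) P P ≡ 0ℚ
    cost-self P = trans (sumℚ-cong P term≡0) (sumℚ-0 P)
      where
      term≡0 : ∀ {x} → x ∈ P → w x *ℚ distTo (d M) x P ≡ 0ℚ
      term≡0 {x} x∈P = trans (cong (w x *ℚ_) (distTo-self M x∈P)) (ℚₚ.*-zeroʳ (w x))

    cost-self-≤ : ∀ m P → costOn (d M) P P ≤ℚ ℕ→ℚ m *ℚ costOn (d M) P T
    cost-self-≤ m P = ℚₚ.≤-trans (ℚₚ.≤-reflexive (cost-self P)) (*-nonneg (ℕ→ℚ-mono {b = m} z≤n) (cost-nonneg P T))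

    T-nonempty : 1 ≤ length T
    T-nonempty = subst (1 ≤_) (sym |T|≡k) 1≤k

    distTo-projection : ∀ R 1≤|R| {R′} → R′ ⊆ R → 1 ≤ length R′ → ∀ x →
      distTo (d M) x (map (nearest (d M) R 1≤|R|) T) ≤ℚ ℕ→ℚ 2 *ℚ distTo (d M) x T +ℚ distTo (d M) x R′
    distTo-projection R 1≤|R| {R′} R′⊆R 1≤|R′| x
      with distTo-attained (d M) x T T-nonempty | distTo-attained (d M) x R′ 1≤|R′|
    ... | t , t∈T , dist-T≡ | r , r∈R′ , dist-R′≡ = begin
      distTo (d M) x (map h T)     ≤⟨ distTo-≤ (d M) x (∈-map⁺ h t∈T) ⟩
      d M x (h t)                  ≤⟨ detour-≤ M x t (nearest-≤ (d M) R 1≤|R| t (R′⊆R r∈R′)) ⟩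
      ℕ→ℚ 2 *ℚ d M x t +ℚ d M x r ≡⟨ sym (cong₂ (λ u v → ℕ→ℚ 2 *ℚ u +ℚ v) dist-T≡ dist-R′≡) ⟩
      ℕ→ℚ 2 *ℚ distTo (d M) x T +ℚ distTo (d M) x R′ ∎
      where
      open ℚₚ.≤-Reasoning
      h = nearest (d M) R 1≤|R|

    cost-projection : ∀ R 1≤|R| Q R′ → R′ ⊆ R → (1 ≤ length Q → 1 ≤ length R′) → ∀ m →
      costOn (d M) Q R′ ≤ℚ ℕ→ℚ m *ℚ costOn (d M) Q T →
      costOn (d M) Q (map (nearest (d M) R 1≤|R|) T) ≤ℚ ℕ→ℚ (2 + m) *ℚ costOn (d M) Q T
    cost-projection R 1≤|R| Q R′ R′⊆R R′-nonempty m cost-R′≤ = begin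
      costOn (d M) Q (map (nearest (d M) R 1≤|R|) T)
        ≤⟨ sumℚ-mono Q (λ {x} x∈Q → w*-mono x (distTo-projection R 1≤|R| R′⊆R (R′-nonempty (∈⇒nonempty x∈Q)) x)) ⟩
      sumℚ (λ x → w x *ℚ (ℕ→ℚ 2 *ℚ dist-T x +ℚ dist-R′ x)) Q
        ≡⟨ sumℚ-cong Q (λ {x} _ → distrib (w x) (dist-T x) (dist-R′ x)) ⟩
      sumℚ (λ x → ℕ→ℚ 2 *ℚ (w x *ℚ dist-T x) +ℚ w x *ℚ dist-R′ x) Q
        ≡⟨ sumℚ-+ _ _ Q ⟩
      sumℚ (λ x → ℕ→ℚ 2 *ℚ (w x *ℚ dist-T x)) Q +ℚ costOn (d M) Q R′
        ≡⟨ cong (_+ℚ costOn (d M) Q R′) (sumℚ-*ˡ (ℕ→ℚ 2) _ Q) ⟩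
      ℕ→ℚ 2 *ℚ costOn (d M) Q T +ℚ costOn (d M) Q R′
        ≤⟨ ℚₚ.+-monoʳ-≤ (ℕ→ℚ 2 *ℚ costOn (d M) Q T) cost-R′≤ ⟩
      ℕ→ℚ 2 *ℚ costOn (d M) Q T +ℚ ℕ→ℚ m *ℚ costOn (d M) Q T
        ≡⟨ sym (ℚₚ.*-distribʳ-+ (costOn (d M) Q T) (ℕ→ℚ 2) (ℕ→ℚ m)) ⟩
      (ℕ→ℚ 2 +ℚ ℕ→ℚ m) *ℚ costOn (d M) Q T
        ≡⟨ cong (_*ℚ costOn (d M) Q T) (sym (ℕ→ℚ-+ 2 m)) ⟩
      ℕ→ℚ (2 + m) *ℚ costOn (d M) Q T ∎
      where
      open ℚₚ.≤-Reasoning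
      open +-*-Solver
      dist-T dist-R′ : Fin n → ℚ
      dist-T x = distTo (d M) x T
      dist-R′ x = distTo (d M) x R′
      distrib : ∀ a b c → a *ℚ (ℕ→ℚ 2 *ℚ b +ℚ c) ≡ ℕ→ℚ 2 *ℚ (a *ℚ b) +ℚ a *ℚ c
      distrib = solve 3 (λ a b c → a :* (con (ℕ→ℚ 2) :* b :+ c) := con (ℕ→ℚ 2) :* (a :* b) :+ a :* c) refl

    centres-approx : ∀ D L P → length P ≤ k * 2 ^ L →
                     costOn (d M) P (centres D P) ≤ℚ ℕ→ℚ (2 * L) *ℚ costOn (d M) P T
    centres-approx zero    L P _ = cost-self-≤ (2 * L) P
    centres-approx (suc D) L P size with length P ≤? k
    centres-approx (suc D) L       P size | yes _ = cost-self-≤ (2 * L) P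
    centres-approx (suc D) zero    P size | no |P|≰k =
      contradiction (subst (length P ≤_) (ℕₚ.*-identityʳ k) size) |P|≰k
    centres-approx (suc D) (suc L) P size | no |P|≰k = begin
      costOn (d M) P (bestCentres (d M) P R)       ≤⟨ bestCentres-optimal (d M) P R c*∈ ⟩
      costOn (d M) P c*                            ≡⟨ costOn-halves (d M) P c* ⟩
      costOn (d M) P₁ c* +ℚ costOn (d M) P₂ c*
        ≤⟨ ℚₚ.+-mono-≤
             (cost-projection R 1≤|R| P₁ R₁ ∈-++⁺ˡ (centres-nonempty D P₁ 1≤k) (2 * L) (centres-approx D L P₁ size₁))
             (cost-projection R 1≤|R| P₂ R₂ (∈-++⁺ʳ R₁) (centres-nonempty D P₂ 1≤k) (2 * L) (centres-approx D L P₂ size₂)) ⟩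
      q *ℚ costOn (d M) P₁ T +ℚ q *ℚ costOn (d M) P₂ T  ≡⟨ sym (ℚₚ.*-distribˡ-+ q _ _) ⟩
      q *ℚ (costOn (d M) P₁ T +ℚ costOn (d M) P₂ T)   ≡⟨ cong₂ _*ℚ_ (cong ℕ→ℚ (sym (ℕₚ.*-suc 2 L)))
                                                              (sym (costOn-halves (d M) P T)) ⟩
      ℕ→ℚ (2 * suc L) *ℚ costOn (d M) P T            ∎
      where
      open ℚₚ.≤-Reasoning
      q : ℚ
      q = ℕ→ℚ (2 + 2 * L)
      P₁ P₂ R₁ R₂ R : List (Fin n)
      P₁ = firstHalf P
      P₂ = secondHalf P
      R₁ = centres D P₁
      R₂ = centres D P₂
      R = R₁ ++ R₂
      size₁ : length P₁ ≤ k * 2 ^ L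
      size₁ = proj₁ (halves-≤-2^ k L P size)
      size₂ : length P₂ ≤ k * 2 ^ L
      size₂ = proj₂ (halves-≤-2^ k L P size)
      1≤|R| : 1 ≤ length R
      1≤|R| = ℕₚ.≤-trans (centres-nonempty D P₁ 1≤k (firstHalf-nonempty P (ℕₚ.≤-trans (s≤s z≤n) (ℕₚ.≰⇒> |P|≰k))))
                        (Listₚ.length-++-≤ˡ R₁)
      c* : List (Fin n)
      c* = map (nearest (d M) R 1≤|R|) T
      c*⊆R : c* ⊆ R
      c*⊆R z∈c* with ∈-map⁻ _ z∈c*
      ... | t , _ , refl = nearest-∈ (d M) R 1≤|R| t
      c*∈ : c* ∈ tuples k R
      c*∈ = subst (λ j → c* ∈ tuples j R) (trans (Listₚ.length-map _ T) |T|≡k) (∈-tuples⁺ c*⊆R)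

module Guarantees (n k : ℕ) (w : Weights n) (M : Metric n) (1≤k : 1 ≤ k) where
  open KMedian n k w
  open Semantics (d M)

  S : List (Fin n)
  S = proj₁ (run kMedian (d M))

  q : ℕ
  q = proj₂ (run kMedian (d M))

  length-allFin : length (allFin n) ≡ n
  length-allFin = Listₚ.length-tabulate id

  allFin-≤ : ∀ {m} → n ≤ m → length (allFin n) ≤ m
  allFin-≤ = ℕₚ.≤-trans (ℕₚ.≤-reflexive length-allFin)

  n≤k*2^ : ∀ L → n ≤ 2 ^ L → n ≤ k * 2 ^ L
  n≤k*2^ L n≤2^L = ℕₚ.≤-trans n≤2^L (ℕₚ.m≤n*m (2 ^ L) k {{>-nonZero 1≤k}})

  kMedian-size : k ≤ n → 1 ≤ length S × length S ≤ k
  kMedian-size k≤n rewrite run-solveOn n (allFin n) =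
    centres-nonempty n (allFin n) 1≤k (subst (1 ≤_) (sym length-allFin) (ℕₚ.≤-trans 1≤k k≤n)) ,
    centres-length n (allFin n) (allFin-≤ (n≤k*2^ n (ℕₚ.<⇒≤ (n<2^n n))))

  kMedian-approx : NonNegWeights w → ∀ L → n ≤ k * 2 ^ L → ∀ T → length T ≡ k →
                   cost (d M) w S ≤ℚ ℕ→ℚ (2 * (1 + L)) *ℚ cost (d M) w T
  kMedian-approx w≥0 L n≤ T |T|≡k rewrite run-solveOn n (allFin n) =
    ℚₚ.≤-trans (centres-approx n L (allFin n) (allFin-≤ n≤))
      (ℚₚ.*-monoʳ-≤-nonNeg _ {{nonNegative (cost-nonneg (allFin n) T)}}
        (ℕ→ℚ-mono (ℕₚ.*-monoʳ-≤ 2 (ℕₚ.n≤1+n L))))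
    where open Approximation M w≥0 1≤k T |T|≡k

  kMedian-queries : ∀ a b → n ≤ 2 ^ a → q ≤ 2 * n * k * (1 + a + b) ^ 2
  kMedian-queries a b n≤2^a rewrite run-solveOn n (allFin n) = begin
    queries n (allFin n)             ≤⟨ queries-≤ n a (allFin n) (allFin-≤ (n≤k*2^ n (ℕₚ.<⇒≤ (n<2^n n))))
                                                                 (allFin-≤ (n≤k*2^ a n≤2^a)) ⟩
    a * length (allFin n) * (k + k)  ≡⟨ cong (λ m → a * m * (k + k)) length-allFin ⟩
    a * n * (k + k)                  ≡⟨ reorder a n k ⟩
    2 * n * k * a                    ≤⟨ ℕₚ.*-monoʳ-≤ (2 * n * k) a≤[1+a+b]² ⟩
    2 * n * k * (1 + a + b) ^ 2      ∎
    where
    open ℕₚ.≤-Reasoning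
    open ℕ-Solver.+-*-Solver using (solve; _:+_; _:*_; _:=_; con)
    reorder : ∀ a n k → a * n * (k + k) ≡ 2 * n * k * a
    reorder = solve 3 (λ a n k → a :* n :* (k :+ k) := con 2 :* n :* k :* a) refl
    a≤[1+a+b]² : a ≤ (1 + a + b) ^ 2
    a≤[1+a+b]² = ℕₚ.≤-trans (ℕₚ.≤-trans (ℕₚ.n≤1+n a) (ℕₚ.m≤m+n (1 + a) b))
                            (ℕₚ.m≤m*n (1 + a + b) ((1 + a + b) * 1))

theorem3p4 : Σ ((n k : ℕ) → Weights n → QueryAlg n) λ A →
    Σ ℕ λ C →
      ∀ (n k : ℕ) (w : Weights n) (M : Metric n) →
      NonNegWeights w → 1 ≤ k → k ≤ n →
      let S = proj₁ (run (A n k w) (d M))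
          q = proj₂ (run (A n k w) (d M))
      in
      -- output is a nonempty set of at most k centres
      (1 ≤ length S × length S ≤ k)
      -- approximation: cost(S) ≤ C·(1 + ⌈log₂(n/k)⌉)·OPT_k(V)
      × (∀ (L : ℕ) → n ≤ k * 2 ^ L →
           ∀ (T : List (Fin n)) → Unique T → length T ≡ k →
             cost (d M) w S ≤ℚ ℕ→ℚ (C * (1 + L)) *ℚ cost (d M) w T)
      -- queries: Õ(nk), polylog in n and the aspect ratio Δ
      × (∀ (a b : ℕ) → n ≤ 2 ^ a → AspectRatio≤2^ M b →
           q ≤ C * n * k * (1 + a + b) ^ C)
theorem3p4 = KMedian.kMedian , 2 , λ n k w M w≥0 1≤k k≤n →
  let open Guarantees n k w M 1≤k in
  kMedian-size k≤n ,
  (λ L n≤k*2^L T _ |T|≡k → kMedian-approx w≥0 L n≤k*2^L T |T|≡k) ,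
  (λ a b n≤2^a _ → kMedian-queries a b n≤2^a)
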